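{- (1) If $\pi^\varepsilon$ is a pattern of $\gamma^{\varepsilon'}$ in the peg pattern order, then $\mathrm{Grid}(\pi^\varepsilon)\subseteq \mathrm{Grid}(\gamma^{\varepsilon'})$ and $\mathrm{Grid}_{peg}(\pi^\varepsilon)\subseteq \mathrm{Grid}_{peg}(\gamma^{\varepsilon'})$. (2) If $\pi^\varepsilon\in\hat B_k^{(rd)}$, then $\mathrm{Grid}(\pi^\varepsilon)\subseteq B_k^{(rd)}$ and $\mathrm{Grid}_{peg}(\pi^\varepsilon)\subseteq \hat B_k^{(rd)}$.
   Context: A peg permutation of length $n$ is a word $\pi_1^{\varepsilon_1}\cdots\pi_n^{\varepsilon_n}$ with $\pi_1\cdots\pi_n$ a permutation of $\{1,\dots,n\}$ in one-line notation and $\varepsilon_i\in\{+,-,\bullet\}$. Peg pattern order: $\sigma^\delta$ of length $m$ is a pattern of $\tau^\varepsilon$ if there are $i_1<\dots<i_m$ with $\tau_{i_1}\cdots\tau_{i_m}$ order-isomorphic to $\sigma$ and, for each $j$, $\delta_j\in\{+,-\}$ implies $\varepsilon_{i_j}=\delta_j$. Reversals: for a standard permutation a reversal reverses a factor; $rd(\pi)$ is the minimum number sorting $\pi$ to the identity; $B_k^{(rd)}$ = all permutations with $rd\le k$. For a peg permutation a reversal reverses a factor and swaps $+\leftrightarrow-$ on the reversed entries ($\bullet$ unchanged); $rd(\pi^\varepsilon)$ is the minimum number turning $\pi^\varepsilon$ into a peg permutation with identity underlying permutation and decorations in $\{+,\bullet\}$; $\hat B_k^{(rd)}$ = peg permutations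 with $rd\le k$. For a peg permutation $\pi^\varepsilon$ of length $n$, a vector $v$ of nonnegative integers is legal if $v_i\in\{0,1\}$ whenever $\varepsilon_i=\bullet$. The monotone inflation $\pi^\varepsilon[v]$ replaces each $\pi_i$ by a block of $v_i$ entries forming an increasing run of consecutive values if $\varepsilon_i=+$, a decreasing run if $\varepsilon_i=-$, and a single entry or nothing if $\varepsilon_i=\bullet$, with all entries of block $i$ below those of block $j$ whenever $\pi_i<\pi_j$; $\mathrm{Grid}(\pi^\varepsilon)$ is the set of all monotone inflations over legal $v$. Peg monotone inflations are the same but the block for a $+$ entry has each entry decorated $+$ or $\bullet$, the block for a $-$ entry has each entry decorated $-$ or $\bullet$, and a kept $\bullet$ entry stays decorated $\bullet$; $\mathrm{Grid}_{peg}(\pi^\varepsilon)$ is the set of all of them. -}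

module Defs where

open import Data.Nat using (ℕ; zero; suc; _+_; _≤_; _<_; _<ᵇ_)
open import Data.Bool using (if_then_else_)
open import Data.List using (List; []; _∷_; _++_; map; reverse; upTo; zipWith; concat; length; lookup; replicate)
open import Data.List.Relation.Binary.Pointwise using (Pointwise)
open import Data.List.Relation.Unary.All using (All)
open import Data.Nat.ListAction using (sum)
open import Data.List.Relation.Binary.Sublist.Propositional using (_⊆_)
open import Data.List.Relation.Binary.Permutation.Propositional using (_↭_)
open import Data.Fin using (Fin; cast)
open import Data.Product using (Σ; _×_; _,_; proj₁; proj₂; ∃)
open import Data.Sum using (_⊎_)
open import Relation.Binary.PropositionalEquality using (_≡_)
open import Relation.Nullary using (¬_)
open import Function.Bundles using (_⇔_)

Word : Set
Word = List ℕ

identity : ℕ → Word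
identity n = map suc (upTo n)

IsPerm : Word → Set
IsPerm w = w ↭ identity (length w)

data Deco : Set where
  plus minus dot : Deco

PegWord : Set
PegWord = List (ℕ × Deco)

underlying : PegWord → Word
underlying = map proj₁

decos : PegWord → List Deco
decos = map proj₂

IsPegPerm : PegWord → Set
IsPegPerm w = IsPerm (underlying w)

OrderIso : Word → Word → Set
OrderIso xs ys =
  Σ (length xs ≡ length ys) λ eq →
    (i j : Fin (length xs)) →
      (lookup xs i < lookup xs j) ⇔ (lookup ys (cast eq i) < lookup ys (cast eq j))

DecoCompat : Deco → Deco → Set
DecoCompat δ ε = (δ ≡ plus → ε ≡ plus) × (δ ≡ minus → ε ≡ minus)

PegPattern : PegWord → PegWord → Set
PegPattern σ τ = ∃ λ s → (s ⊆ τ) × OrderIso (underlying σ) (underlying s)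
                              × Pointwise DecoCompat (decos σ) (decos s)

Reversal : Word → Word → Set
Reversal w w' = ∃ λ a → ∃ λ b → ∃ λ c → (w ≡ a ++ b ++ c) × (w' ≡ a ++ reverse b ++ c)

flipDeco : Deco → Deco
flipDeco plus  = minus
flipDeco minus = plus
flipDeco dot   = dot

flipEntry : ℕ × Deco → ℕ × Deco
flipEntry (x , d) = x , flipDeco d

PegReversal : PegWord → PegWord → Set
PegReversal w w' = ∃ λ a → ∃ λ b → ∃ λ c →
  (w ≡ a ++ b ++ c) × (w' ≡ a ++ map flipEntry (reverse b) ++ c)

data Steps {A : Set} (R : A → A → Set) : ℕ → A → A → Set where
  done : ∀ {x} → Steps R zero x x
  step : ∀ {m x y z} → R x y → Steps R m y z → Steps R (suc m) x z

RdLe : ℕ → Word → Set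
RdLe k w = ∃ λ m → (m ≤ k) × Steps Reversal m w (identity (length w))

SortedPeg : PegWord → Set
SortedPeg w = (underlying w ≡ identity (length w)) × All (λ d → ¬ (d ≡ minus)) (decos w)

PegRdLe : ℕ → PegWord → Set
PegRdLe k w = ∃ λ m → (m ≤ k) × ∃ λ w' → Steps PegReversal m w w' × SortedPeg w'

B : ℕ → Word → Set
B k w = IsPerm w × RdLe k w

PegB : ℕ → PegWord → Set
PegB k w = IsPegPerm w × PegRdLe k w

Legal : PegWord → List ℕ → Set
Legal π v = Pointwise (λ e vi → proj₂ e ≡ dot → vi ≤ 1) π v

-- number of inflated entries lying below the block of value p
offset : PegWord → List ℕ → ℕ → ℕ
offset π v p = sum (zipWith (λ e vi → if proj₁ e <ᵇ p then vi else 0) π v)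

block : ℕ → Deco → ℕ → Word
block o plus  vi = map (λ j → o + suc j) (upTo vi)
block o minus vi = reverse (map (λ j → o + suc j) (upTo vi))
block o dot   vi = map (λ j → o + suc j) (upTo vi)   -- vi ∈ {0,1}

inflate : PegWord → List ℕ → Word
inflate π v = concat (zipWith (λ e vi → block (offset π v (proj₁ e)) (proj₂ e) vi) π v)

inflateDecos : PegWord → List ℕ → List Deco
inflateDecos π v = concat (zipWith (λ e vi → replicate vi (proj₂ e)) π v)

Allowed : Deco → Deco → Set
Allowed plus  d = (d ≡ plus) ⊎ (d ≡ dot)
Allowed minus d = (d ≡ minus) ⊎ (d ≡ dot)
Allowed dot   d = d ≡ dot

Grid : PegWord → Word → Set
Grid π σ = ∃ λ v → Legal π v × (σ ≡ inflate π v)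

GridPeg : PegWord → PegWord → Set
GridPeg π τ = ∃ λ v → Legal π v × (underlying τ ≡ inflate π v)
                    × Pointwise Allowed (inflateDecos π v) (decos τ)

-- A peg word π^ε with a legal vector v is encoded as a list of cells (πᵢ^εᵢ , vᵢ); the block of a cell
-- starts right after the total size of the cells of smaller value.
-- (1) If π^ε occurs in γ^ε′, relabel every cell of π by the matching entry of γ and give the other entries
-- of γ empty blocks. The values are in the same relative order, so no offset changes, and the decorations
-- are compatible, so no block changes (a • block has at most one entry) and every decoration allowed in a
-- block of π stays allowed in the corresponding block of γ.
-- (2) Reversing a factor of π^ε and flipping its decorations reverses exactly the factor of the inflation
-- formed by the corresponding blocks: flipping a decoration reverses its block, and the offsets only depend
-- on the multiset of cells. Hence a sorting sequence of peg reversals lifts to one of the same length for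
-- the inflation, ending at the inflation of a sorted peg word, which is the identity since its blocks are
-- increasing and consecutive. Sorting the cells by value and straightening every block in the same way shows
-- that the inflation of a permutation is a permutation.

module Submission where

open import Defs
open import Data.Nat using (ℕ; zero; suc; _+_; _≤_; _<_; _<ᵇ_; z≤n; s≤s)
open import Data.Nat.Properties
  using (<ᵇ⇒<; <⇒<ᵇ; ≤⇒≯; +-identityʳ; +-suc; +-assoc; ≤-reflexive; m≤n⇒m≤1+n; suc-injective)
open import Data.Nat.ListAction using (sum)
open import Data.Nat.ListAction.Properties using (sum-++; sum-↭)
open import Data.Bool using (true; false; if_then_else_; T)
open import Data.Bool.Properties using (T-≡)
open import Data.List
  using (List; []; _∷_; _++_; [_]; map; reverse; upTo; applyUpTo; zipWith; concat; concatMap; length; lookup; replicate)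
open import Data.List.Properties
  using ( ∷-injective; ++-assoc; ++-identityʳ; map-++; map-∘; map-cong; map-id; map-upTo; map-replicate
        ; length-++; length-map; length-reverse; length-replicate; length-upTo
        ; concatMap-++; concatMap-cong; concatMap-map; map-concatMap
        ; unfold-reverse; reverse-++; reverse-map; reverse-involutive )
open import Data.List.Relation.Binary.Pointwise as Pointwise using (Pointwise; []; _∷_)
open import Data.List.Relation.Binary.Sublist.Heterogeneous using (Sublist; []; _∷ʳ_; _∷_)
open import Data.List.Relation.Unary.All as All using (All; []; _∷_)
import Data.List.Relation.Unary.All.Properties as All
open import Data.List.Relation.Binary.Permutation.Propositional as ↭
  using (_↭_; ↭-refl; ↭-trans; ↭-sym; ↭-reflexive; module PermutationReasoning)
open import Data.List.Relation.Binary.Permutation.Propositional.Properties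
  using (↭-length; ↭-reverse; ↭-map-inv; ++⁺; ++⁺ˡ; shifts; All-resp-↭)
import Data.List.Relation.Binary.Permutation.Propositional.Properties as Perm
open import Data.Fin using (cast)
open import Data.Fin.Properties using (toℕ-injective; toℕ-cast)
open import Data.Product using (∃; _×_; _,_; proj₁; proj₂)
open import Data.Sum using (inj₁; inj₂)
open import Data.Empty using (⊥-elim)
open import Relation.Binary.PropositionalEquality
  using (_≡_; refl; sym; trans; cong; cong₂; subst; subst₂; module ≡-Reasoning)
open import Relation.Nullary using (¬_)
open import Function using (_∘_)
open import Function.Bundles using (_⇔_; Equivalence; mk⇔)

T-⇔⇒≡ : ∀ {p q} → (T p ⇔ T q) → p ≡ q
T-⇔⇒≡ {false} {false} _   = refl
T-⇔⇒≡ {false} {true}  p⇔q = ⊥-elim (Equivalence.from p⇔q _)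
T-⇔⇒≡ {true}  {false} p⇔q = ⊥-elim (Equivalence.to p⇔q _)
T-⇔⇒≡ {true}  {true}  _   = refl

<ᵇ-cong : ∀ {a x b y} → (a < x ⇔ b < y) → (a <ᵇ x) ≡ (b <ᵇ y)
<ᵇ-cong {a} {x} {b} {y} a<x⇔b<y = T-⇔⇒≡ (mk⇔
  (<⇒<ᵇ ∘ Equivalence.to a<x⇔b<y ∘ <ᵇ⇒< a x)
  (<⇒<ᵇ ∘ Equivalence.from a<x⇔b<y ∘ <ᵇ⇒< b y))

pointwise-lookup : ∀ {A B : Set} {R : A → B → Set} {xs ys} (eq : length xs ≡ length ys) →
                   (∀ i → R (lookup xs i) (lookup ys (cast eq i))) → Pointwise R xs ys
pointwise-lookup {R = R} {xs} {ys} eq r = Pointwise.lookup⁻ eq λ {i} {j} i≡j →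
  subst (λ k → R (lookup xs i) (lookup ys k)) (toℕ-injective (trans (toℕ-cast eq i) i≡j)) (r i)

pointwise-map⁻ˡ : ∀ {A B C : Set} {R : C → B → Set} (f : A → C) {xs ys} →
                  Pointwise R (map f xs) ys → Pointwise (λ x y → R (f x) y) xs ys
pointwise-map⁻ˡ f {[]}    {[]}    []       = []
pointwise-map⁻ˡ f {_ ∷ _} {_ ∷ _} (r ∷ rs) = r ∷ pointwise-map⁻ˡ f rs

pointwise-zip : ∀ {A B : Set} {R S : A → B → Set} {xs ys} →
                Pointwise R xs ys → Pointwise S xs ys → Pointwise (λ x y → R x y × S x y) xs ys
pointwise-zip []       []       = []
pointwise-zip (r ∷ rs) (s ∷ ss) = (r , s) ∷ pointwise-zip rs ss

All-pointwise : ∀ {A B : Set} {P : A → Set} {R : A → B → Set} {xs ys} →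
                All P xs → Pointwise R xs ys → Pointwise (λ x y → P x × R x y) xs ys
All-pointwise []       []       = []
All-pointwise (p ∷ ps) (r ∷ rs) = (p , r) ∷ All-pointwise ps rs

pointwise⇒Allʳ : ∀ {A B : Set} {P : B → Set} {xs : List A} {ys} → Pointwise (λ _ y → P y) xs ys → All P ys
pointwise⇒Allʳ []       = []
pointwise⇒Allʳ (p ∷ ps) = p ∷ pointwise⇒Allʳ ps

pointwise-++⁻ : ∀ {A B : Set} {R : A → B → Set} xs ys {xs′ ys′} → length xs ≡ length ys →
                Pointwise R (xs ++ xs′) (ys ++ ys′) → Pointwise R xs ys × Pointwise R xs′ ys′
pointwise-++⁻ []       []       _  rs       = [] , rs
pointwise-++⁻ (x ∷ xs) (y ∷ ys) eq (r ∷ rs) with pointwise-++⁻ xs ys (suc-injective eq) rs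
... | rs₁ , rs₂ = r ∷ rs₁ , rs₂

map-split : ∀ {A B : Set} (f : A → B) xs ys zs → map f xs ≡ ys ++ zs →
            ∃ λ xs₁ → ∃ λ xs₂ → (xs ≡ xs₁ ++ xs₂) × (map f xs₁ ≡ ys) × (map f xs₂ ≡ zs)
map-split f xs       []       zs eq = [] , xs , refl , refl , eq
map-split f (x ∷ xs) (y ∷ ys) zs eq with ∷-injective eq
... | refl , eq′ with map-split f xs ys zs eq′
... | xs₁ , xs₂ , refl , refl , refl = x ∷ xs₁ , xs₂ , refl , refl , refl

map-reverseFactor : ∀ {A B : Set} (f : A → B) {h : A → A} {k : B → B} → (∀ x → f (h x) ≡ k (f x)) →
                    ∀ xs ys zs →
                    map f (xs ++ map h (reverse ys) ++ zs) ≡ map f xs ++ map k (reverse (map f ys)) ++ map f zs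
map-reverseFactor f {h} {k} f∘h≗k∘f xs ys zs = begin
  map f (xs ++ map h (reverse ys) ++ zs)               ≡⟨ map-++ f xs _ ⟩
  map f xs ++ map f (map h (reverse ys) ++ zs)         ≡⟨ cong (map f xs ++_) (map-++ f (map h (reverse ys)) zs) ⟩
  map f xs ++ map f (map h (reverse ys)) ++ map f zs   ≡⟨ cong (λ w → map f xs ++ w ++ map f zs) middle ⟩
  map f xs ++ map k (reverse (map f ys)) ++ map f zs   ∎
  where
  open ≡-Reasoning
  middle : map f (map h (reverse ys)) ≡ map k (reverse (map f ys))
  middle = begin
    map f (map h (reverse ys)) ≡⟨ map-∘ (reverse ys) ⟨
    map (f ∘ h) (reverse ys)   ≡⟨ map-cong f∘h≗k∘f (reverse ys) ⟩
    map (k ∘ f) (reverse ys)   ≡⟨ map-∘ (reverse ys) ⟩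
    map k (map f (reverse ys)) ≡⟨ cong (map k) (reverse-map f ys) ⟩
    map k (reverse (map f ys)) ∎

concatMap-cong-All : ∀ {A B : Set} {F G : A → List B} {xs} → All (λ x → F x ≡ G x) xs →
                     concatMap F xs ≡ concatMap G xs
concatMap-cong-All []         = refl
concatMap-cong-All (eq ∷ eqs) = cong₂ _++_ eq (concatMap-cong-All eqs)

concatMap-↭ : ∀ {A B : Set} (F : A → List B) {xs ys} → xs ↭ ys → concatMap F xs ↭ concatMap F ys
concatMap-↭ F ↭.refl              = ↭-refl
concatMap-↭ F (↭.prep x xs↭ys)    = ++⁺ˡ (F x) (concatMap-↭ F xs↭ys)
concatMap-↭ F (↭.swap x y xs↭ys)  =
  ↭-trans (shifts (F x) (F y)) (++⁺ˡ (F y) (++⁺ˡ (F x) (concatMap-↭ F xs↭ys)))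
concatMap-↭ F (↭.trans xs↭ys ys↭zs) = ↭-trans (concatMap-↭ F xs↭ys) (concatMap-↭ F ys↭zs)

concatMap-↭-cong : ∀ {A B : Set} {F G : A → List B} → (∀ x → F x ↭ G x) →
                   ∀ xs → concatMap F xs ↭ concatMap G xs
concatMap-↭-cong F↭G []       = ↭-refl
concatMap-↭-cong F↭G (x ∷ xs) = ++⁺ (F↭G x) (concatMap-↭-cong F↭G xs)

concatMap-reverse : ∀ {A B : Set} (F : A → List B) xs →
                    concatMap (reverse ∘ F) (reverse xs) ≡ reverse (concatMap F xs)
concatMap-reverse F []       = refl
concatMap-reverse F (x ∷ xs) = begin
  concatMap (reverse ∘ F) (reverse (x ∷ xs))
    ≡⟨ cong (concatMap (reverse ∘ F)) (unfold-reverse x xs) ⟩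
  concatMap (reverse ∘ F) (reverse xs ++ [ x ])
    ≡⟨ concatMap-++ (reverse ∘ F) (reverse xs) [ x ] ⟩
  concatMap (reverse ∘ F) (reverse xs) ++ reverse (F x) ++ []
    ≡⟨ cong₂ _++_ (concatMap-reverse F xs) (++-identityʳ (reverse (F x))) ⟩
  reverse (concatMap F xs) ++ reverse (F x)
    ≡⟨ reverse-++ (F x) (concatMap F xs) ⟨
  reverse (F x ++ concatMap F xs)
    ∎
  where open ≡-Reasoning

reverse-replicate : ∀ {A : Set} n (x : A) → reverse (replicate n x) ≡ replicate n x
reverse-replicate zero    x = refl
reverse-replicate (suc n) x = begin
  reverse (x ∷ replicate n x)      ≡⟨ unfold-reverse x (replicate n x) ⟩
  reverse (replicate n x) ++ [ x ] ≡⟨ cong (_++ [ x ]) (reverse-replicate n x) ⟩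
  replicate n x ++ [ x ]           ≡⟨ snoc n ⟩
  x ∷ replicate n x                ∎
  where
  open ≡-Reasoning
  snoc : ∀ m → replicate m x ++ [ x ] ≡ x ∷ replicate m x
  snoc zero    = refl
  snoc (suc m) = cong (x ∷_) (snoc m)

applyUpTo-cong : ∀ {A : Set} {f g : ℕ → A} n → (∀ j → f j ≡ g j) → applyUpTo f n ≡ applyUpTo g n
applyUpTo-cong {f = f} {g} n f≗g = trans (sym (map-upTo f n)) (trans (map-cong f≗g (upTo n)) (map-upTo g n))

applyUpTo-++ : ∀ {A : Set} (f : ℕ → A) m n →
               applyUpTo f m ++ applyUpTo (λ j → f (m + j)) n ≡ applyUpTo f (m + n)
applyUpTo-++ f zero    n = refl
applyUpTo-++ f (suc m) n = cong (f 0 ∷_) (applyUpTo-++ (f ∘ suc) m n)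

length-identity : ∀ n → length (identity n) ≡ n
length-identity n = trans (length-map suc (upTo n)) (length-upTo n)

≡identity⇒≡identity-length : ∀ {w n} → w ≡ identity n → w ≡ identity (length w)
≡identity⇒≡identity-length {n = n} refl = cong identity (sym (length-identity n))

SameOrder : Word → Word → Set
SameOrder xs ys = Pointwise (λ x y → Pointwise (λ x′ y′ → x′ < x ⇔ y′ < y) xs ys) xs ys

orderIso⇒sameOrder : ∀ {xs ys} → OrderIso xs ys → SameOrder xs ys
orderIso⇒sameOrder (eq , iso) = pointwise-lookup eq λ i → pointwise-lookup eq λ j → iso j i

-- Decorations and blocks

_⊑_ : Deco → Deco → Set
d ⊑ d′ = ∀ e → Allowed d e → Allowed d′ e

compatible⇒⊑ : ∀ {d d′} → DecoCompat d d′ → d ⊑ d′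
compatible⇒⊑ {plus}  (d′≡plus , _)  rewrite d′≡plus refl  = λ _ a → a
compatible⇒⊑ {minus} (_ , d′≡minus) rewrite d′≡minus refl = λ _ a → a
compatible⇒⊑ {dot} {plus}  _ _ refl = inj₂ refl
compatible⇒⊑ {dot} {minus} _ _ refl = inj₂ refl
compatible⇒⊑ {dot} {dot}   _ _ refl = refl

allowed-⊑ : ∀ {xs ys zs} → Pointwise _⊑_ xs ys → Pointwise Allowed xs zs → Pointwise Allowed ys zs
allowed-⊑ []         []         = []
allowed-⊑ (x⊑y ∷ ⊑s) (a ∷ as) = x⊑y _ a ∷ allowed-⊑ ⊑s as

legal-compatible : ∀ {d d′ n} → DecoCompat d d′ → (d ≡ dot → n ≤ 1) → d′ ≡ dot → n ≤ 1
legal-compatible {plus}  (d′≡plus , _)  _     refl with d′≡plus refl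
... | ()
legal-compatible {minus} (_ , d′≡minus) _     refl with d′≡minus refl
... | ()
legal-compatible {dot}   _              legal _    = legal refl

block-compatible : ∀ o {d d′} n → DecoCompat d d′ → (d ≡ dot → n ≤ 1) → block o d n ≡ block o d′ n
block-compatible o {plus}  n (d′≡plus , _)  _ rewrite d′≡plus refl  = refl
block-compatible o {minus} n (_ , d′≡minus) _ rewrite d′≡minus refl = refl
block-compatible o {dot} {plus}  0 _ _ = refl
block-compatible o {dot} {minus} 0 _ _ = refl
block-compatible o {dot} {dot}   0 _ _ = refl
block-compatible o {dot} {plus}  1 _ _ = refl
block-compatible o {dot} {minus} 1 _ _ = refl
block-compatible o {dot} {dot}   1 _ _ = refl
block-compatible o {dot} (suc (suc n)) _ legal with legal refl
... | s≤s ()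

allowed-flip : ∀ {d e} → Allowed d e → Allowed (flipDeco d) (flipDeco e)
allowed-flip {plus}  (inj₁ refl) = inj₁ refl
allowed-flip {plus}  (inj₂ refl) = inj₂ refl
allowed-flip {minus} (inj₁ refl) = inj₁ refl
allowed-flip {minus} (inj₂ refl) = inj₂ refl
allowed-flip {dot}   refl        = refl

block-flip : ∀ o d n → (d ≡ dot → n ≤ 1) → block o (flipDeco d) n ≡ reverse (block o d n)
block-flip o plus  n _ = refl
block-flip o minus n _ = sym (reverse-involutive _)
block-flip o dot   0 _ = refl
block-flip o dot   1 _ = refl
block-flip o dot   (suc (suc n)) legal with legal refl
... | s≤s ()

NotMinus : Deco → Set
NotMinus d = ¬ d ≡ minus

allowed-notMinus : ∀ {d e} → NotMinus d → Allowed d e → NotMinus e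
allowed-notMinus {plus}  _ (inj₁ refl) ()
allowed-notMinus {plus}  _ (inj₂ refl) ()
allowed-notMinus {minus} m _           = ⊥-elim (m refl)
allowed-notMinus {dot}   _ refl        ()

allowed-All-notMinus : ∀ {ds es} → All NotMinus ds → Pointwise Allowed ds es → All NotMinus es
allowed-All-notMinus []       []       = []
allowed-All-notMinus (m ∷ ms) (a ∷ as) = allowed-notMinus m a ∷ allowed-All-notMinus ms as

block-↭-plus : ∀ o d n → block o d n ↭ block o plus n
block-↭-plus o plus  n = ↭-refl
block-↭-plus o minus n = ↭-reverse _
block-↭-plus o dot   n = ↭-refl

length-block : ∀ o d n → length (block o d n) ≡ n
length-block o plus  n = trans (length-map _ (upTo n)) (length-upTo n)
length-block o minus n = trans (length-reverse (block o plus n)) (length-block o plus n)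
length-block o dot   n = length-block o plus n

interval : ℕ → ℕ → Word
interval o n = applyUpTo (λ j → o + suc j) n

block-plus : ∀ o n → block o plus n ≡ interval o n
block-plus o n = map-upTo (λ j → o + suc j) n

interval-++ : ∀ o m n → interval o m ++ interval (o + m) n ≡ interval o (m + n)
interval-++ o m n = trans (cong (interval o m ++_) (applyUpTo-cong n shift)) (applyUpTo-++ (λ j → o + suc j) m n)
  where
  shift : ∀ j → o + m + suc j ≡ o + suc (m + j)
  shift j = trans (+-assoc o m (suc j)) (cong (o +_) (+-suc m j))

-- Cells

Cell : Set
Cell = (ℕ × Deco) × ℕ

entry : Cell → ℕ × Deco
entry = proj₁

value : Cell → ℕ
value c = proj₁ (entry c)

deco : Cell → Deco
deco c = proj₂ (entry c)

size : Cell → ℕ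
size = proj₂

LegalCell : Cell → Set
LegalCell c = deco c ≡ dot → size c ≤ 1

sizeBelow : ℕ → Cell → ℕ
sizeBelow p c = if value c <ᵇ p then size c else 0

below : List Cell → ℕ → ℕ
below cs p = sum (map (sizeBelow p) cs)

blockIn : List Cell → Cell → Word
blockIn cs c = block (below cs (value c)) (deco c) (size c)

inflation : List Cell → Word
inflation cs = concatMap (blockIn cs) cs

decoRun : Cell → List Deco
decoRun c = replicate (size c) (deco c)

inflationDecos : List Cell → List Deco
inflationDecos = concatMap decoRun

PegOver : List Cell → PegWord → Set
PegOver cs τ = (underlying τ ≡ inflation cs) × Pointwise Allowed (inflationDecos cs) (decos τ)

CellGrid : PegWord → Word → Set
CellGrid π σ = ∃ λ cs → (map entry cs ≡ π) × All LegalCell cs × (σ ≡ inflation cs)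

CellGridPeg : PegWord → PegWord → Set
CellGridPeg π τ = ∃ λ cs → (map entry cs ≡ π) × All LegalCell cs × PegOver cs τ

zipWith-unzip : ∀ {A : Set} (f : ℕ × Deco → ℕ → A) (cs : List Cell) →
                zipWith f (map entry cs) (map size cs) ≡ map (λ c → f (entry c) (size c)) cs
zipWith-unzip f []       = refl
zipWith-unzip f (c ∷ cs) = cong (_ ∷_) (zipWith-unzip f cs)

offset-cells : ∀ cs p → offset (map entry cs) (map size cs) p ≡ below cs p
offset-cells cs p = cong sum (zipWith-unzip _ cs)

inflate-cells : ∀ cs → inflate (map entry cs) (map size cs) ≡ inflation cs
inflate-cells cs = cong concat (trans (zipWith-unzip _ cs)
  (map-cong (λ c → cong (λ o → block o (deco c) (size c)) (offset-cells cs (value c))) cs))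

inflateDecos-cells : ∀ cs → inflateDecos (map entry cs) (map size cs) ≡ inflationDecos cs
inflateDecos-cells cs = cong concat (zipWith-unzip _ cs)

legal⇒cells : ∀ {π v} → Legal π v → ∃ λ cs → (map entry cs ≡ π) × (map size cs ≡ v) × All LegalCell cs
legal⇒cells []         = [] , refl , refl , []
legal⇒cells (l ∷ ls) with legal⇒cells ls
... | cs , refl , refl , legal = (_ ∷ cs) , refl , refl , l ∷ legal

cells⇒legal : ∀ {cs} → All LegalCell cs → Legal (map entry cs) (map size cs)
cells⇒legal []       = []
cells⇒legal (l ∷ ls) = l ∷ cells⇒legal ls

grid⇒cellGrid : ∀ {π σ} → Grid π σ → CellGrid π σ
grid⇒cellGrid (_ , l , σ≡) with legal⇒cells l
... | cs , refl , refl , legal = cs , refl , legal , trans σ≡ (inflate-cells cs)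

cellGrid⇒grid : ∀ {π σ} → CellGrid π σ → Grid π σ
cellGrid⇒grid (cs , refl , legal , σ≡) = map size cs , cells⇒legal legal , trans σ≡ (sym (inflate-cells cs))

gridPeg⇒cellGridPeg : ∀ {π τ} → GridPeg π τ → CellGridPeg π τ
gridPeg⇒cellGridPeg (_ , l , τ≡ , allowed) with legal⇒cells l
... | cs , refl , refl , legal =
  cs , refl , legal , trans τ≡ (inflate-cells cs) ,
  subst (λ ds → Pointwise Allowed ds _) (inflateDecos-cells cs) allowed

cellGridPeg⇒gridPeg : ∀ {π τ} → CellGridPeg π τ → GridPeg π τ
cellGridPeg⇒gridPeg (cs , refl , legal , τ≡ , allowed) =
  map size cs , cells⇒legal legal , trans τ≡ (sym (inflate-cells cs)) ,
  subst (λ ds → Pointwise Allowed ds _) (sym (inflateDecos-cells cs)) allowed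

values-entries : ∀ cs → underlying (map entry cs) ≡ map value cs
values-entries cs = sym (map-∘ cs)

length-entries : ∀ cs → length (underlying (map entry cs)) ≡ length cs
length-entries cs = trans (length-map proj₁ (map entry cs)) (length-map entry cs)

sizes : List Cell → ℕ
sizes cs = sum (map size cs)

sizeBelow-< : ∀ {p} c → value c < p → sizeBelow p c ≡ size c
sizeBelow-< c lt = cong (λ b → if b then size c else 0) (Equivalence.to T-≡ (<⇒<ᵇ lt))

sizeBelow-≥ : ∀ {p} c → p ≤ value c → sizeBelow p c ≡ 0
sizeBelow-≥ {p} c p≤ with value c <ᵇ p in lt
... | false = refl
... | true  = ⊥-elim (≤⇒≯ p≤ (<ᵇ⇒< (value c) p (Equivalence.from T-≡ lt)))

below-cong : ∀ {x y cs ds} → Pointwise (λ c d → (value c < x ⇔ value d < y) × size c ≡ size d) cs ds →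
             below cs x ≡ below ds y
below-cong []                    = refl
below-cong ((iff , size≡) ∷ rs) =
  cong₂ _+_ (cong₂ (λ b n → if b then n else 0) (<ᵇ-cong iff) size≡) (below-cong rs)

below-++ : ∀ cs ds p → below (cs ++ ds) p ≡ below cs p + below ds p
below-++ cs ds p = trans (cong sum (map-++ (sizeBelow p) cs ds)) (sum-++ (map (sizeBelow p) cs) _)

below-all-< : ∀ {cs p} → All (λ c → value c < p) cs → below cs p ≡ sizes cs
below-all-< []             = refl
below-all-< (_∷_ {c} lt lts) = cong₂ _+_ (sizeBelow-< c lt) (below-all-< lts)

below-↭ : ∀ {cs ds} → cs ↭ ds → ∀ p → below cs p ≡ below ds p
below-↭ cs↭ds p = sum-↭ (Perm.map⁺ (sizeBelow p) cs↭ds)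

blocks-cong : ∀ {cs ds} → (∀ p → below cs p ≡ below ds p) →
              ∀ xs → concatMap (blockIn cs) xs ≡ concatMap (blockIn ds) xs
blocks-cong below≡ = concatMap-cong λ c → cong (λ o → block o (deco c) (size c)) (below≡ (value c))

-- Peg patterns

relabel : List Cell → PegWord → List Cell
relabel = zipWith (λ c e → e , size c)

entries-relabel : ∀ {R : Cell → ℕ × Deco → Set} {cs es} → Pointwise R cs es → map entry (relabel cs es) ≡ es
entries-relabel []       = refl
entries-relabel (_ ∷ rs) = cong (_ ∷_) (entries-relabel rs)

pointwise-relabel : ∀ {R : Cell → ℕ × Deco → Set} {cs es} → Pointwise R cs es →
                    Pointwise (λ c d → R c (entry d) × size c ≡ size d) cs (relabel cs es)
pointwise-relabel []       = []
pointwise-relabel (r ∷ rs) = (r , refl) ∷ pointwise-relabel rs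

OrderedLike : List Cell → PegWord → Cell → ℕ × Deco → Set
OrderedLike cs es c e = Pointwise (λ c′ e′ → value c′ < value c ⇔ proj₁ e′ < proj₁ e) cs es

sameOrder⇒ordered : ∀ {cs es} → SameOrder (underlying (map entry cs)) (underlying es) →
                    Pointwise (OrderedLike cs es) cs es
sameOrder⇒ordered = Pointwise.map onCells ∘ onCells
  where
  onCells : ∀ {R : ℕ → ℕ → Set} {cs es} → Pointwise R (underlying (map entry cs)) (underlying es) →
            Pointwise (λ c e → R (value c) (proj₁ e)) cs es
  onCells = pointwise-map⁻ˡ entry ∘ Pointwise.map⁻ proj₁ proj₁

module Relabelling {cs : List Cell} {es : PegWord} (legalCells : All LegalCell cs)
  (iso : OrderIso (underlying (map entry cs)) (underlying es))
  (compat : Pointwise DecoCompat (decos (map entry cs)) (decos es))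
  where

  Similar : Cell → ℕ × Deco → Set
  Similar c e = LegalCell c × DecoCompat (deco c) (proj₂ e) × OrderedLike cs es c e

  similar : Pointwise Similar cs es
  similar = All-pointwise legalCells
    (pointwise-zip (pointwise-map⁻ˡ entry (Pointwise.map⁻ proj₂ proj₂ compat)) (sameOrder⇒ordered (orderIso⇒sameOrder iso)))

  ds : List Cell
  ds = relabel cs es

  record Match (c d : Cell) : Set where
    field
      legal      : LegalCell c
      compatible : DecoCompat (deco c) (deco d)
      below≡     : below cs (value c) ≡ below ds (value d)
      size≡      : size c ≡ size d

  matches : Pointwise Match cs ds
  matches = Pointwise.map toMatch (pointwise-relabel similar)
    where
    toMatch : ∀ {c d} → Similar c (entry d) × size c ≡ size d → Match c d
    toMatch {c} {d} ((legal , compatible , ordered) , size≡) = record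
      { legal      = legal
      ; compatible = compatible
      ; below≡     = below-cong {value c} {value d} (pointwise-relabel ordered)
      ; size≡      = size≡
      }

  entries-relabelled : map entry ds ≡ es
  entries-relabelled = entries-relabel similar

  legal-relabelled : All LegalCell ds
  legal-relabelled = pointwise⇒Allʳ (Pointwise.map legal-match matches)
    where
    legal-match : ∀ {c d} → Match c d → LegalCell d
    legal-match {d = d} m = subst (λ n → deco d ≡ dot → n ≤ 1) size≡ (legal-compatible compatible legal)
      where open Match m

  inflation-relabelled : inflation ds ≡ inflation cs
  inflation-relabelled = sym (cong concat (Pointwise.Pointwise-≡⇒≡
    (Pointwise.map⁺ (blockIn cs) (blockIn ds) (Pointwise.map block-match matches))))
    where
    block-match : ∀ {c d} → Match c d → blockIn cs c ≡ blockIn ds d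
    block-match {c} {d} m = begin
      block (below cs (value c)) (deco c) (size c) ≡⟨ cong (λ o → block o (deco c) (size c)) below≡ ⟩
      block (below ds (value d)) (deco c) (size c) ≡⟨ block-compatible _ (size c) compatible legal ⟩
      block (below ds (value d)) (deco d) (size c) ≡⟨ cong (block _ (deco d)) size≡ ⟩
      block (below ds (value d)) (deco d) (size d) ∎
      where
      open ≡-Reasoning
      open Match m

  decos-relabelled : Pointwise _⊑_ (inflationDecos cs) (inflationDecos ds)
  decos-relabelled = Pointwise.concat⁺ (Pointwise.map⁺ decoRun decoRun (Pointwise.map run-match matches))
    where
    run-match : ∀ {c d} → Match c d → Pointwise _⊑_ (decoRun c) (decoRun d)
    run-match {c} {d} m = subst (λ n → Pointwise _⊑_ (decoRun c) (replicate n (deco d))) (Match.size≡ m)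
      (Pointwise.replicate⁺ (compatible⇒⊑ (Match.compatible m)) (size c))

data Padding : List Cell → List Cell → Set where
  []   : Padding [] []
  pad  : ∀ {cs ds} e → Padding cs ds → Padding cs ((e , 0) ∷ ds)
  keep : ∀ {cs ds} c → Padding cs ds → Padding (c ∷ cs) (c ∷ ds)

below-padding : ∀ {cs ds} → Padding cs ds → ∀ p → below ds p ≡ below cs p
below-padding []          p = refl
below-padding (pad e pd)  p with proj₁ e <ᵇ p
... | true  = below-padding pd p
... | false = below-padding pd p
below-padding (keep c pd) p = cong (sizeBelow p c +_) (below-padding pd p)

blocks-padding : ∀ {cs ds} → Padding cs ds → ∀ xs → concatMap (blockIn xs) ds ≡ concatMap (blockIn xs) cs
blocks-padding []                   xs = refl
blocks-padding (pad (_ , plus) pd)  xs = blocks-padding pd xs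
blocks-padding (pad (_ , minus) pd) xs = blocks-padding pd xs
blocks-padding (pad (_ , dot) pd)   xs = blocks-padding pd xs
blocks-padding (keep c pd)          xs = cong (blockIn xs c ++_) (blocks-padding pd xs)

inflation-padding : ∀ {cs ds} → Padding cs ds → inflation ds ≡ inflation cs
inflation-padding {cs} {ds} pd = trans (blocks-padding pd ds) (blocks-cong {ds} {cs} (below-padding pd) cs)

decos-padding : ∀ {cs ds} → Padding cs ds → inflationDecos ds ≡ inflationDecos cs
decos-padding []          = refl
decos-padding (pad e pd)  = decos-padding pd
decos-padding (keep c pd) = cong (decoRun c ++_) (decos-padding pd)

legal-padding : ∀ {cs ds} → Padding cs ds → All LegalCell cs → All LegalCell ds
legal-padding []          []             = []
legal-padding (pad e pd)  legal          = (λ _ → z≤n) ∷ legal-padding pd legal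
legal-padding (keep c pd) (l ∷ legal)    = l ∷ legal-padding pd legal

sublist⇒padding : ∀ {es γ} → Sublist _≡_ es γ → ∀ cs → map entry cs ≡ es →
                  ∃ λ ds → Padding cs ds × map entry ds ≡ γ
sublist⇒padding []          []       refl = [] , [] , refl
sublist⇒padding (e ∷ʳ sub)  cs       refl with sublist⇒padding sub cs refl
... | ds , pd , refl = (e , 0) ∷ ds , pad e pd , refl
sublist⇒padding (refl ∷ sub) (c ∷ cs) refl with sublist⇒padding sub cs refl
... | ds , pd , refl = c ∷ ds , keep c pd , refl

pattern-cells : ∀ {cs γ} → All LegalCell cs → PegPattern (map entry cs) γ →
                ∃ λ ds → (map entry ds ≡ γ) × All LegalCell ds × (inflation ds ≡ inflation cs)
                       × Pointwise _⊑_ (inflationDecos cs) (inflationDecos ds)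
pattern-cells {cs} legal (es , sub , iso , compat)
  with sublist⇒padding sub (Relabelling.ds legal iso compat) (Relabelling.entries-relabelled legal iso compat)
... | padded , pd , refl =
  padded , refl , legal-padding pd legal-relabelled , trans (inflation-padding pd) inflation-relabelled ,
  subst (Pointwise _⊑_ (inflationDecos cs)) (sym (decos-padding pd)) decos-relabelled
  where open Relabelling legal iso compat

grid-monotone : ∀ {π γ σ} → PegPattern π γ → Grid π σ → Grid γ σ
grid-monotone pat g with grid⇒cellGrid g
... | cs , refl , legal , refl with pattern-cells legal pat
... | ds , refl , legal′ , inflation≡ , _ = cellGrid⇒grid (ds , refl , legal′ , sym inflation≡)

gridPeg-monotone : ∀ {π γ τ} → PegPattern π γ → GridPeg π τ → GridPeg γ τ
gridPeg-monotone pat g with gridPeg⇒cellGridPeg g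
... | cs , refl , legal , τ≡ , allowed with pattern-cells legal pat
... | ds , refl , legal′ , inflation≡ , ⊑s =
  cellGridPeg⇒gridPeg (ds , refl , legal′ , trans τ≡ (sym inflation≡) , allowed-⊑ ⊑s allowed)

-- Sorted inflations

data Consecutive : ℕ → List Cell → Set where
  []  : ∀ {s} → Consecutive s []
  _∷_ : ∀ {s c cs} → value c ≡ suc s → Consecutive (suc s) cs → Consecutive s (c ∷ cs)

values⇒consecutive : ∀ s cs → map value cs ≡ applyUpTo (λ j → suc (s + j)) (length cs) → Consecutive s cs
values⇒consecutive s []       _  = []
values⇒consecutive s (c ∷ cs) eq with ∷-injective eq
... | c≡ , cs≡ = trans c≡ (cong suc (+-identityʳ s))
               ∷ values⇒consecutive (suc s) cs (trans cs≡ (applyUpTo-cong (length cs) λ j → cong suc (+-suc s j)))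

below-consecutive : ∀ {s cs p} → Consecutive s cs → p ≤ suc s → below cs p ≡ 0
below-consecutive []                    _  = refl
below-consecutive {p = p} (_∷_ {c = c} c≡ cons) p≤ =
  cong₂ _+_ (sizeBelow-≥ {p} c (subst (p ≤_) (sym c≡) p≤)) (below-consecutive cons (m≤n⇒m≤1+n p≤))

plusBlockIn : List Cell → Cell → Word
plusBlockIn cs c = block (below cs (value c)) plus (size c)

plusBlocks-consecutive : ∀ {cs} P S s → cs ≡ P ++ S → Consecutive s S → All (λ c → value c ≤ s) P →
                         concatMap (plusBlockIn cs) S ≡ interval (sizes P) (sizes S)
plusBlocks-consecutive         P []      s _    []            _   = refl
plusBlocks-consecutive {cs} P (c ∷ S) s refl (c≡ ∷ cons) P≤s = begin
  plusBlockIn cs c ++ concatMap (plusBlockIn cs) S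
    ≡⟨ cong₂ _++_ (trans (cong (λ o → block o plus (size c)) below≡) (block-plus (sizes P) (size c))) rest ⟩
  interval (sizes P) (size c) ++ interval (sizes P + size c) (sizes S)
    ≡⟨ interval-++ (sizes P) (size c) (sizes S) ⟩
  interval (sizes P) (size c + sizes S) ∎
  where
  open ≡-Reasoning
  P<c : All (λ c′ → value c′ < value c) P
  P<c = All.map (λ v≤s → subst (_ <_) (sym c≡) (s≤s v≤s)) P≤s
  c≤ : value c ≤ suc s
  c≤ = ≤-reflexive c≡
  below≡ : below (P ++ c ∷ S) (value c) ≡ sizes P
  below≡ = begin
    below (P ++ c ∷ S) (value c)                ≡⟨ below-++ P (c ∷ S) (value c) ⟩
    below P (value c) + below (c ∷ S) (value c) ≡⟨ cong₂ _+_ (below-all-< P<c) (below-consecutive {s} {c ∷ S} (c≡ ∷ cons) c≤) ⟩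
    sizes P + 0                                 ≡⟨ +-identityʳ (sizes P) ⟩
    sizes P                                     ∎
  sizes-snoc : sizes (P ++ [ c ]) ≡ sizes P + size c
  sizes-snoc = trans (cong sum (map-++ size P [ c ]))
                     (trans (sum-++ (map size P) [ size c ]) (cong (sizes P +_) (+-identityʳ (size c))))
  rest : concatMap (plusBlockIn (P ++ c ∷ S)) S ≡ interval (sizes P + size c) (sizes S)
  rest = trans (plusBlocks-consecutive (P ++ [ c ]) S (suc s) (sym (++-assoc P [ c ] S)) cons
                 (All.++⁺ (All.map m≤n⇒m≤1+n P≤s) (c≤ ∷ [])))
               (cong (λ o → interval o (sizes S)) sizes-snoc)

plusInflation : List Cell → Word
plusInflation cs = concatMap (plusBlockIn cs) cs

plusInflation-sorted : ∀ {cs} → map value cs ≡ identity (length cs) → plusInflation cs ≡ identity (sizes cs)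
plusInflation-sorted {cs} sorted =
  trans (plusBlocks-consecutive [] cs 0 refl (values⇒consecutive 0 cs (trans sorted (map-upTo suc (length cs)))) [])
        (sym (map-upTo suc (sizes cs)))

blockIn-notMinus : ∀ cs c → NotMinus (deco c) → blockIn cs c ≡ plusBlockIn cs c
blockIn-notMinus cs ((_ , plus) , _)  _ = refl
blockIn-notMinus cs ((_ , minus) , _) m = ⊥-elim (m refl)
blockIn-notMinus cs ((_ , dot) , _)   _ = refl

inflation-sorted : ∀ {cs} → map value cs ≡ identity (length cs) → All (NotMinus ∘ deco) cs →
                   inflation cs ≡ identity (length (inflation cs))
inflation-sorted {cs} sorted notMinus = ≡identity⇒≡identity-length
  (trans (concatMap-cong-All (All.map (λ {c} → blockIn-notMinus cs c) notMinus)) (plusInflation-sorted sorted))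

inflation-↭-identity : ∀ {cs} → map value cs ↭ identity (length cs) →
                       inflation cs ↭ identity (length (inflation cs))
inflation-↭-identity {cs} values↭ with ↭-map-inv value values↭
... | ds , identity≡ , cs↭ds =
  ↭-trans inflation↭ (↭-reflexive (cong identity (sym (trans (↭-length inflation↭) (length-identity (sizes ds))))))
  where
  open PermutationReasoning
  sorted : map value ds ≡ identity (length ds)
  sorted = trans (sym identity≡) (cong identity (↭-length cs↭ds))
  inflation↭ : inflation cs ↭ identity (sizes ds)
  inflation↭ = begin
    concatMap (blockIn cs) cs ↭⟨ concatMap-↭ (blockIn cs) cs↭ds ⟩
    concatMap (blockIn cs) ds ≡⟨ blocks-cong {cs} {ds} (below-↭ cs↭ds) ds ⟩
    concatMap (blockIn ds) ds ↭⟨ concatMap-↭-cong (λ c → block-↭-plus _ (deco c) (size c)) ds ⟩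
    plusInflation ds          ≡⟨ plusInflation-sorted sorted ⟩
    identity (sizes ds)       ∎

pegPerm⇒perm : ∀ {cs} → IsPegPerm (map entry cs) → IsPerm (inflation cs)
pegPerm⇒perm {cs} perm = inflation-↭-identity
  (subst₂ (λ w n → w ↭ identity n) (values-entries cs) (length-entries cs) perm)

sortedPeg⇒sorted : ∀ {cs} → SortedPeg (map entry cs) →
                   (map value cs ≡ identity (length cs)) × All (NotMinus ∘ deco) cs
sortedPeg⇒sorted {cs} (sorted , notMinus) =
  subst₂ (λ w n → w ≡ identity n) (values-entries cs) (length-map entry cs) sorted ,
  All.map⁻ (All.map⁻ notMinus)

notMinus-decos : ∀ {cs} → All (NotMinus ∘ deco) cs → All NotMinus (inflationDecos cs)
notMinus-decos []                 = []
notMinus-decos (_∷_ {c} m ms) = All.++⁺ (All.replicate⁺ (size c) m) (notMinus-decos ms)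

-- Reversals

flipCell : Cell → Cell
flipCell c = flipEntry (entry c) , size c

reverseFactor : List Cell → List Cell → List Cell → List Cell
reverseFactor xs ys zs = xs ++ map flipCell (reverse ys) ++ zs

legal-flip : ∀ c → LegalCell c → LegalCell (flipCell c)
legal-flip ((_ , plus) , _)  _     ()
legal-flip ((_ , minus) , _) _     ()
legal-flip ((_ , dot) , _)   legal refl = legal refl

below-reverseFactor : ∀ xs ys zs p → below (reverseFactor xs ys zs) p ≡ below (xs ++ ys ++ zs) p
below-reverseFactor xs ys zs p = begin
  below (xs ++ ys′ ++ zs) p                 ≡⟨ below-++ xs _ p ⟩
  below xs p + below (ys′ ++ zs) p          ≡⟨ cong (below xs p +_) (below-++ ys′ zs p) ⟩
  below xs p + (below ys′ p + below zs p)   ≡⟨ cong (λ n → below xs p + (n + below zs p)) flipped ⟩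
  below xs p + (below ys p + below zs p)    ≡⟨ cong (below xs p +_) (below-++ ys zs p) ⟨
  below xs p + below (ys ++ zs) p           ≡⟨ below-++ xs _ p ⟨
  below (xs ++ ys ++ zs) p                  ∎
  where
  open ≡-Reasoning
  ys′ : List Cell
  ys′ = map flipCell (reverse ys)
  flipped : below ys′ p ≡ below ys p
  flipped = trans (cong sum (sym (map-∘ (reverse ys)))) (below-↭ (↭-reverse ys) p)

inflation-reverseFactor : ∀ xs ys zs → All LegalCell ys → let Q = xs ++ ys ++ zs in
  inflation (reverseFactor xs ys zs)
    ≡ concatMap (blockIn Q) xs ++ reverse (concatMap (blockIn Q) ys) ++ concatMap (blockIn Q) zs
inflation-reverseFactor xs ys zs legal = begin
  concatMap (blockIn Q′) Q′
    ≡⟨ blocks-cong {Q′} {Q} (below-reverseFactor xs ys zs) Q′ ⟩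
  concatMap (blockIn Q) (xs ++ map flipCell (reverse ys) ++ zs)
    ≡⟨ concatMap-++ (blockIn Q) xs _ ⟩
  X ++ concatMap (blockIn Q) (map flipCell (reverse ys) ++ zs)
    ≡⟨ cong (X ++_) (concatMap-++ (blockIn Q) (map flipCell (reverse ys)) zs) ⟩
  X ++ concatMap (blockIn Q) (map flipCell (reverse ys)) ++ Z
    ≡⟨ cong (λ w → X ++ w ++ Z) reversed ⟩
  X ++ reverse (concatMap (blockIn Q) ys) ++ Z
    ∎
  where
  open ≡-Reasoning
  Q Q′ : List Cell
  Q  = xs ++ ys ++ zs
  Q′ = reverseFactor xs ys zs
  X Z : Word
  X = concatMap (blockIn Q) xs
  Z = concatMap (blockIn Q) zs
  blocks-flip : All (λ c → blockIn Q (flipCell c) ≡ reverse (blockIn Q c)) ys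
  blocks-flip = All.map (λ {c} → block-flip (below Q (value c)) (deco c) (size c)) legal
  reversed : concatMap (blockIn Q) (map flipCell (reverse ys)) ≡ reverse (concatMap (blockIn Q) ys)
  reversed = begin
    concatMap (blockIn Q) (map flipCell (reverse ys)) ≡⟨ concatMap-map (blockIn Q) flipCell (reverse ys) ⟩
    concatMap (blockIn Q ∘ flipCell) (reverse ys)     ≡⟨ concatMap-cong-All (All-resp-↭ (↭-sym (↭-reverse ys)) blocks-flip) ⟩
    concatMap (reverse ∘ blockIn Q) (reverse ys)      ≡⟨ concatMap-reverse (blockIn Q) ys ⟩
    reverse (concatMap (blockIn Q) ys)                ∎

decos-reverseFactor : ∀ xs ys zs → inflationDecos (reverseFactor xs ys zs)
  ≡ inflationDecos xs ++ map flipDeco (reverse (inflationDecos ys)) ++ inflationDecos zs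
decos-reverseFactor xs ys zs = begin
  inflationDecos (xs ++ map flipCell (reverse ys) ++ zs)
    ≡⟨ concatMap-++ decoRun xs _ ⟩
  inflationDecos xs ++ inflationDecos (map flipCell (reverse ys) ++ zs)
    ≡⟨ cong (inflationDecos xs ++_) (concatMap-++ decoRun (map flipCell (reverse ys)) zs) ⟩
  inflationDecos xs ++ inflationDecos (map flipCell (reverse ys)) ++ inflationDecos zs
    ≡⟨ cong (λ w → inflationDecos xs ++ w ++ inflationDecos zs) reversed ⟩
  inflationDecos xs ++ map flipDeco (reverse (inflationDecos ys)) ++ inflationDecos zs
    ∎
  where
  open ≡-Reasoning
  decoRun-flip : ∀ c → decoRun (flipCell c) ≡ reverse (map flipDeco (decoRun c))
  decoRun-flip c = trans (sym (reverse-replicate (size c) _)) (cong reverse (sym (map-replicate flipDeco (size c) (deco c))))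
  reversed : inflationDecos (map flipCell (reverse ys)) ≡ map flipDeco (reverse (inflationDecos ys))
  reversed = begin
    concatMap decoRun (map flipCell (reverse ys))        ≡⟨ concatMap-map decoRun flipCell (reverse ys) ⟩
    concatMap (decoRun ∘ flipCell) (reverse ys)          ≡⟨ concatMap-cong decoRun-flip (reverse ys) ⟩
    concatMap (reverse ∘ map flipDeco ∘ decoRun) (reverse ys) ≡⟨ concatMap-reverse (map flipDeco ∘ decoRun) ys ⟩
    reverse (concatMap (map flipDeco ∘ decoRun) ys)      ≡⟨ cong reverse (map-concatMap flipDeco decoRun ys) ⟨
    reverse (map flipDeco (inflationDecos ys))           ≡⟨ reverse-map flipDeco (inflationDecos ys) ⟨
    map flipDeco (reverse (inflationDecos ys))           ∎

length-blocks : ∀ cs xs → length (concatMap (blockIn cs) xs) ≡ length (inflationDecos xs)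
length-blocks cs []       = refl
length-blocks cs (c ∷ xs) = begin
  length (blockIn cs c ++ concatMap (blockIn cs) xs)           ≡⟨ length-++ (blockIn cs c) ⟩
  length (blockIn cs c) + length (concatMap (blockIn cs) xs)   ≡⟨ cong₂ _+_ block≡run (length-blocks cs xs) ⟩
  length (decoRun c) + length (inflationDecos xs)              ≡⟨ length-++ (decoRun c) ⟨
  length (decoRun c ++ inflationDecos xs)                      ∎
  where
  open ≡-Reasoning
  block≡run : length (blockIn cs c) ≡ length (decoRun c)
  block≡run = trans (length-block _ (deco c) (size c)) (sym (length-replicate (size c)))

length-underlying-decos : ∀ t → length (underlying t) ≡ length (decos t)
length-underlying-decos t = trans (length-map proj₁ t) (sym (length-map proj₂ t))

pegReversal-lift : ∀ {τ} xa xb xc da db dc → length da ≡ length xa → length db ≡ length xb →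
  underlying τ ≡ xa ++ xb ++ xc → Pointwise Allowed (da ++ db ++ dc) (decos τ) →
  ∃ λ τ′ → PegReversal τ τ′ × (underlying τ′ ≡ xa ++ reverse xb ++ xc)
         × Pointwise Allowed (da ++ map flipDeco (reverse db) ++ dc) (decos τ′)
pegReversal-lift {τ} xa xb xc da db dc |da| |db| τ≡ allowed with map-split proj₁ τ xa (xb ++ xc) τ≡
... | ta , tr , refl , refl , tr≡ with map-split proj₁ tr xb xc tr≡
... | tb , tc , refl , refl , refl
  with pointwise-++⁻ da (decos ta) (trans |da| (length-underlying-decos ta))
                     (subst (Pointwise Allowed _) (map-++ proj₂ ta _) allowed)
... | allowed-a , allowed-bc
  with pointwise-++⁻ db (decos tb) (trans |db| (length-underlying-decos tb))
                     (subst (Pointwise Allowed _) (map-++ proj₂ tb tc) allowed-bc)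
... | allowed-b , allowed-c =
  ta ++ map flipEntry (reverse tb) ++ tc , (ta , tb , tc , refl , refl) ,
  trans (map-reverseFactor proj₁ (λ _ → refl) ta tb tc) (cong (λ w → xa ++ w ++ xc) (map-id (reverse xb))) ,
  subst (Pointwise Allowed _) (sym (map-reverseFactor proj₂ (λ _ → refl) ta tb tc))
        (Pointwise.++⁺ allowed-a (Pointwise.++⁺ allowed-flipped allowed-c))
  where
  allowed-flipped : Pointwise Allowed (map flipDeco (reverse db)) (map flipDeco (reverse (decos tb)))
  allowed-flipped = Pointwise.map⁺ flipDeco flipDeco (Pointwise.map allowed-flip (Pointwise.reverse⁺ allowed-b))

record LiftedReversal (cs : List Cell) (w′ : PegWord) : Set where
  field
    cells′      : List Cell
    entries′    : map entry cells′ ≡ w′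
    legal′      : All LegalCell cells′
    reversal    : Reversal (inflation cs) (inflation cells′)
    pegReversal : ∀ {τ} → PegOver cs τ → ∃ λ τ′ → PegReversal τ τ′ × PegOver cells′ τ′

lift-reversal : ∀ {cs w′} → All LegalCell cs → PegReversal (map entry cs) w′ → LiftedReversal cs w′
lift-reversal {cs} legal (a , b , c , cs≡ , refl) with map-split entry cs a (b ++ c) cs≡
... | xs , rest , refl , refl , rest≡ with map-split entry rest b c rest≡
... | ys , zs , refl , refl , refl = record
  { cells′      = reverseFactor xs ys zs
  ; entries′    = map-reverseFactor entry (λ _ → refl) xs ys zs
  ; legal′      = All.++⁺ legal-xs (All.++⁺ legal-flipped legal-zs)
  ; reversal    = X , Y , Z , inflation-split , inflation-reverseFactor xs ys zs legal-ys
  ; pegReversal = peg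
  }
  where
  Q : List Cell
  Q = xs ++ ys ++ zs
  X Y Z : Word
  X = concatMap (blockIn Q) xs
  Y = concatMap (blockIn Q) ys
  Z = concatMap (blockIn Q) zs
  legal-xs : All LegalCell xs
  legal-xs = proj₁ (All.++⁻ xs legal)
  legal-ys : All LegalCell ys
  legal-ys = proj₁ (All.++⁻ ys (proj₂ (All.++⁻ xs legal)))
  legal-zs : All LegalCell zs
  legal-zs = proj₂ (All.++⁻ ys (proj₂ (All.++⁻ xs legal)))
  legal-flipped : All LegalCell (map flipCell (reverse ys))
  legal-flipped = All.map⁺ (All.map (λ {c} → legal-flip c) (All-resp-↭ (↭-sym (↭-reverse ys)) legal-ys))
  split : ∀ {B : Set} (F : Cell → List B) → concatMap F Q ≡ concatMap F xs ++ concatMap F ys ++ concatMap F zs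
  split F = trans (concatMap-++ F xs (ys ++ zs)) (cong (concatMap F xs ++_) (concatMap-++ F ys zs))
  inflation-split : inflation Q ≡ X ++ Y ++ Z
  inflation-split = split (blockIn Q)
  peg : ∀ {τ} → PegOver Q τ → ∃ λ τ′ → PegReversal τ τ′ × PegOver (reverseFactor xs ys zs) τ′
  peg (τ≡ , allowed) with pegReversal-lift X Y Z (inflationDecos xs) (inflationDecos ys) (inflationDecos zs)
                            (sym (length-blocks Q xs)) (sym (length-blocks Q ys))
                            (trans τ≡ inflation-split) (subst (λ ds → Pointwise Allowed ds _) (split decoRun) allowed)
  ... | τ′ , rev , τ′≡ , allowed′ =
    τ′ , rev , trans τ′≡ (sym (inflation-reverseFactor xs ys zs legal-ys)) ,
    subst (λ ds → Pointwise Allowed ds _) (sym (decos-reverseFactor xs ys zs)) allowed′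

lift-reversals : ∀ {m w w′ cs} → Steps PegReversal m w w′ → map entry cs ≡ w → All LegalCell cs →
  ∃ λ cs′ → (map entry cs′ ≡ w′) × All LegalCell cs′ × Steps Reversal m (inflation cs) (inflation cs′)
lift-reversals done        refl legal = _ , refl , legal , done
lift-reversals (step r rs) refl legal with lift-reversal legal r
... | lifted with lift-reversals rs (LiftedReversal.entries′ lifted) (LiftedReversal.legal′ lifted)
... | cs′ , entries , legal′ , steps = cs′ , entries , legal′ , step (LiftedReversal.reversal lifted) steps

lift-pegReversals : ∀ {m w w′ cs τ} → Steps PegReversal m w w′ → map entry cs ≡ w → All LegalCell cs →
  PegOver cs τ →
  ∃ λ cs′ → ∃ λ τ′ → (map entry cs′ ≡ w′) × Steps PegReversal m τ τ′ × PegOver cs′ τ′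
lift-pegReversals done        refl legal over = _ , _ , refl , done , over
lift-pegReversals (step r rs) refl legal over with lift-reversal legal r
... | lifted with LiftedReversal.pegReversal lifted over
... | τ₁ , rev , over₁ with lift-pegReversals rs (LiftedReversal.entries′ lifted) (LiftedReversal.legal′ lifted) over₁
... | cs′ , τ′ , entries , steps , over′ = cs′ , τ′ , entries , step rev steps , over′

steps-length : ∀ {m x y} → Steps Reversal m x y → length x ≡ length y
steps-length done                                = refl
steps-length (step (a , b , c , refl , refl) rs) =
  trans (↭-length (++⁺ˡ a (Perm.++⁺ʳ c (↭-sym (↭-reverse b))))) (steps-length rs)

grid⊆B : ∀ {k π σ} → PegB k π → Grid π σ → B k σ
grid⊆B (perm , m , m≤k , w′ , steps , sortedPeg) g with grid⇒cellGrid g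
... | cs , refl , legal , refl with lift-reversals steps refl legal
... | cs′ , refl , _ , steps′ with sortedPeg⇒sorted sortedPeg
... | sorted , notMinus =
  pegPerm⇒perm perm , m , m≤k ,
  subst (Steps Reversal m (inflation cs))
        (trans (inflation-sorted sorted notMinus) (cong identity (sym (steps-length steps′)))) steps′

gridPeg⊆PegB : ∀ {k π τ} → PegB k π → GridPeg π τ → PegB k τ
gridPeg⊆PegB (perm , m , m≤k , w′ , steps , sortedPeg) g with gridPeg⇒cellGridPeg g
... | cs , refl , legal , over@(τ≡ , _) with lift-pegReversals steps refl legal over
... | cs′ , τ′ , refl , steps′ , (τ′≡ , allowed′) with sortedPeg⇒sorted sortedPeg
... | sorted , notMinus =
  subst IsPerm (sym τ≡) (pegPerm⇒perm perm) , m , m≤k , τ′ , steps′ ,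
  trans τ′≡ (trans (inflation-sorted sorted notMinus) (cong identity (trans (cong length (sym τ′≡)) (length-map proj₁ τ′)))) ,
  allowed-All-notMinus (notMinus-decos notMinus) allowed′

mainTheorem11 : ((π γ : PegWord) → IsPegPerm π → IsPegPerm γ → PegPattern π γ →
    ((σ : Word) → Grid π σ → Grid γ σ) × ((τ : PegWord) → GridPeg π τ → GridPeg γ τ))
    × ((k : ℕ) (π : PegWord) → PegB k π →
    ((σ : Word) → Grid π σ → B k σ) × ((τ : PegWord) → GridPeg π τ → PegB k τ))
mainTheorem11 = (λ π γ _ _ pat → (λ σ → grid-monotone pat) , (λ τ → gridPeg-monotone pat))
              , (λ k π pegB → (λ σ → grid⊆B pegB) , (λ τ → gridPeg⊆PegB pegB))
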